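{- Let $n\ge 2$, let $\mathbf{i}=\sqrt{ -1}$, and for $a\in\mathbb{C}$ let $B_n(a)$ be the $n\times n$ anti-tridiagonal matrix with $(B_n)_{1,n}=(B_n)_{n,1}=a+\mathbf{i}$, $(B_n)_{k,n+1-k}=a$ for $2\le k\le n-1$, all entries $(B_n)_{k,l}$ with $|k+l-(n+1)|=1$ equal to $\mathbf{i}$, and all other entries $0$. Then $$\det(B_n(1))=\begin{cases}(1+2\mathbf{i})F_n, & n\equiv 0\text{ or }1\pmod 4,\\ -(1+2\mathbf{i})F_n, & n\equiv 2\text{ or }3\pmod 4,\end{cases}$$ and $$\det(B_n(2))=\begin{cases}(2+2\mathbf{i})P_n, & n\equiv 0\text{ or }1\pmod 4,\\ -(2+2\mathbf{i})P_n, & n\equiv 2\text{ or }3\pmod 4.\end{cases}$$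
   Context: $F_n$ is the $n$-th Fibonacci number ($F_0=0$, $F_1=1$, $F_n=F_{n-1}+F_{n-2}$) and $P_n$ the $n$-th Pell number ($P_0=0$, $P_1=1$, $P_n=2P_{n-1}+P_{n-2}$). $B_n(a)$ is the anti-tridiagonal matrix of the paper with parameters $a$ and $b=\mathbf{i}$. -}

module Defs where

open import Data.Nat as ℕ using (ℕ; zero; suc; _≡ᵇ_)
open import Data.Integer as ℤ using (ℤ; +_)
open import Data.Fin using (Fin; toℕ; punchIn)
import Data.Fin as Fin
open import Data.Bool using (Bool; true; false; if_then_else_; _∧_; _∨_)

record ℤ[i] : Set where
  constructor _+_i
  field
    re : ℤ
    im : ℤ
open ℤ[i] public

infixl 6 _⊕_
infixl 7 _⊗_

_⊕_ : ℤ[i] → ℤ[i] → ℤ[i]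
(a + b i) ⊕ (c + d i) = (a ℤ.+ c) + (b ℤ.+ d) i

_⊗_ : ℤ[i] → ℤ[i] → ℤ[i]
(a + b i) ⊗ (c + d i) = (a ℤ.* c ℤ.- b ℤ.* d) + (a ℤ.* d ℤ.+ b ℤ.* c) i

⊖_ : ℤ[i] → ℤ[i]
⊖ (a + b i) = (ℤ.- a) + (ℤ.- b) i

𝟘 𝟙 𝕚 : ℤ[i]
𝟘 = (+ 0) + (+ 0) i
𝟙 = (+ 1) + (+ 0) i
𝕚 = (+ 0) + (+ 1) i

ι : ℕ → ℤ[i]
ι n = (+ n) + (+ 0) i

Matrix : ℕ → Set
Matrix n = Fin n → Fin n → ℤ[i]

Σ : ∀ {n} → (Fin n → ℤ[i]) → ℤ[i]
Σ {zero} f = 𝟘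
Σ {suc n} f = f Fin.zero ⊕ Σ (λ j → f (Fin.suc j))

sgn : ℕ → ℤ[i] → ℤ[i]
sgn zero x = x
sgn (suc k) x = ⊖ sgn k x

det : ∀ n → Matrix n → ℤ[i]
det zero M = 𝟙
det (suc n) M =
  Σ (λ j → sgn (toℕ j) (M Fin.zero j ⊗ det n (λ r c → M (Fin.suc r) (punchIn j c))))

-- B_n(a) with b = i.  Rows/columns 0-indexed: r = k-1, c = l-1, so
-- k + l = n+1  ⇔  r + c + 1 = n ;  k + l = n+2 ⇔ r + c = n ; k + l = n ⇔ r + c + 2 = n.
B : ∀ n → ℤ[i] → Matrix n
B n a r c =
  if (suc s ≡ᵇ n)
    then (if ((toℕ r ≡ᵇ 0) ∨ (toℕ c ≡ᵇ 0)) then a ⊕ 𝕚 else a)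
    else (if ((s ≡ᵇ n) ∨ (suc (suc s) ≡ᵇ n)) then 𝕚 else 𝟘)
  where s = toℕ r ℕ.+ toℕ c

fib : ℕ → ℕ
fib 0 = 0
fib 1 = 1
fib (suc (suc n)) = fib (suc n) ℕ.+ fib n

pell : ℕ → ℕ
pell 0 = 0
pell 1 = 1
pell (suc (suc n)) = 2 ℕ.* pell (suc n) ℕ.+ pell n

module Submission where

-- Work with the general m×m anti-tridiagonal matrix A_m(d): entry d r on the
-- anti-diagonal of row r, entry i on both neighbouring anti-diagonals, 0 elsewhere.
-- Row 0 of A_{m+2}(d) has just two non-zero entries, i in column m and d 0 in
-- column m+1.  Laplace expansion along row 0, and along the first row of the
-- minor of i once more, gives (using i·i = -1) the three-term recurrence
--     det A_{m+2}(d) = - det A_m(drop 2 d) + (-1)^(m+1) · d 0 · det A_{m+1}(drop 1 d),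
-- where drop k d r = d (k + r).  Writing det A_m = (-1)^T(m) · U_m with the
-- triangular number T(m) = m(m-1)/2 makes it sign-free: U_{m+2} = U_m + d 0 · U_{m+1}.
-- For the diagonal (a, …, a, a + i) it is solved by U_m = f_{m+1} + f_m·i, where
-- f_{m+2} = a f_{m+1} + f_m (Fibonacci for a = 1, Pell for a = 2).  B_n(a) is A_n
-- with diagonal (a + i, a, …, a, a + i), so one more step of the recurrence gives
-- det B_{m+2}(a) = (-1)^T(m+2) · (a + 2i) · f_{m+2}; finally (-1)^T(n) = 1 exactly
-- when n ≡ 0, 1 (mod 4).

open import Defs
open import Data.Nat using (ℕ; _≤_; _%_)
open import Data.Integer using (+_)
open import Data.Product using (_×_)
open import Data.Sum using (_⊎_)
open import Relation.Binary.PropositionalEquality using (_≡_)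

open import Data.Nat as ℕ using (zero; suc; _<_; _≡ᵇ_; z≤n; s≤s)
import Data.Nat.Properties as ℕP
import Data.Integer as ℤ
import Data.Integer.Properties as ℤP
open import Data.Integer.Tactic.RingSolver using (solve-∀)
open import Data.Fin as Fin using (Fin; toℕ; punchIn; punchOut; fromℕ; inject₁)
import Data.Fin.Properties as FinP
open import Data.Bool using (Bool; true; false; if_then_else_; _∨_; T)
open import Data.Unit using (tt)
open import Data.Product using (_,_)
open import Data.Sum using (inj₁; inj₂)
open import Relation.Binary.PropositionalEquality
  using (refl; sym; trans; cong; cong₂; subst; subst₂; module ≡-Reasoning)
open import Relation.Nullary using (yes; no)

≡-parts : ∀ {a b c d} → a ≡ c → b ≡ d → (a + b i) ≡ (c + d i)
≡-parts = cong₂ _+_i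

⊕-identityˡ : ∀ x → 𝟘 ⊕ x ≡ x
⊕-identityˡ (a + b i) = ≡-parts (ℤP.+-identityˡ a) (ℤP.+-identityˡ b)

⊕-identityʳ : ∀ x → x ⊕ 𝟘 ≡ x
⊕-identityʳ (a + b i) = ≡-parts (ℤP.+-identityʳ a) (ℤP.+-identityʳ b)

⊗-zeroˡ : ∀ x → 𝟘 ⊗ x ≡ 𝟘
⊗-zeroˡ (c + d i) = ≡-parts (cong₂ ℤ._-_ (ℤP.*-zeroˡ c) (ℤP.*-zeroˡ d))
                            (cong₂ ℤ._+_ (ℤP.*-zeroˡ d) (ℤP.*-zeroˡ c))

⊗-zeroʳ : ∀ x → x ⊗ 𝟘 ≡ 𝟘
⊗-zeroʳ (a + b i) = ≡-parts (cong₂ ℤ._-_ (ℤP.*-zeroʳ a) (ℤP.*-zeroʳ b))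
                            (cong₂ ℤ._+_ (ℤP.*-zeroʳ a) (ℤP.*-zeroʳ b))

⊖-involutive : ∀ x → ⊖ ⊖ x ≡ x
⊖-involutive (a + b i) = ≡-parts (ℤP.neg-involutive a) (ℤP.neg-involutive b)

⊖-distrib-⊕ : ∀ x y → ⊖ (x ⊕ y) ≡ ⊖ x ⊕ ⊖ y
⊖-distrib-⊕ (a + b i) (c + d i) = ≡-parts (ℤP.neg-distrib-+ a c) (ℤP.neg-distrib-+ b d)

⊗-⊖ : ∀ x y → x ⊗ ⊖ y ≡ ⊖ (x ⊗ y)
⊗-⊖ (a + b i) (c + d i) = ≡-parts (real-part a b c d) (imaginary-part a b c d)
  where
  real-part : ∀ (a b c d : ℤ.ℤ) → a ℤ.* (ℤ.- c) ℤ.- b ℤ.* (ℤ.- d) ≡ ℤ.- (a ℤ.* c ℤ.- b ℤ.* d)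
  real-part = solve-∀
  imaginary-part : ∀ (a b c d : ℤ.ℤ) → a ℤ.* (ℤ.- d) ℤ.+ b ℤ.* (ℤ.- c) ≡ ℤ.- (a ℤ.* d ℤ.+ b ℤ.* c)
  imaginary-part = solve-∀

-- i² = -1, the only property of i the recurrence needs.
𝕚-squared : ∀ x → 𝕚 ⊗ (𝕚 ⊗ x) ≡ ⊖ x
𝕚-squared (c + d i) = ≡-parts (real-part c d) (imaginary-part c d)
  where
  real-part : ∀ (c d : ℤ.ℤ) → + 0 ℤ.* (+ 0 ℤ.* c ℤ.- + 1 ℤ.* d) ℤ.- + 1 ℤ.* (+ 0 ℤ.* d ℤ.+ + 1 ℤ.* c) ≡ ℤ.- c
  real-part = solve-∀
  imaginary-part : ∀ (c d : ℤ.ℤ) → + 0 ℤ.* (+ 0 ℤ.* d ℤ.+ + 1 ℤ.* c) ℤ.+ + 1 ℤ.* (+ 0 ℤ.* c ℤ.- + 1 ℤ.* d) ≡ ℤ.- d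
  imaginary-part = solve-∀

sgn-+ : ∀ k l x → sgn (k ℕ.+ l) x ≡ sgn k (sgn l x)
sgn-+ zero    l x = refl
sgn-+ (suc k) l x = cong ⊖_ (sgn-+ k l x)

sgn-⊖ : ∀ k x → sgn k (⊖ x) ≡ ⊖ sgn k x
sgn-⊖ zero    x = refl
sgn-⊖ (suc k) x = cong ⊖_ (sgn-⊖ k x)

sgn-involutive : ∀ k x → sgn k (sgn k x) ≡ x
sgn-involutive zero    x = refl
sgn-involutive (suc k) x = begin
  ⊖ sgn k (⊖ sgn k x)  ≡⟨ cong ⊖_ (sgn-⊖ k (sgn k x)) ⟩
  ⊖ ⊖ sgn k (sgn k x)  ≡⟨ ⊖-involutive _ ⟩
  sgn k (sgn k x)      ≡⟨ sgn-involutive k x ⟩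
  x                    ∎
  where open ≡-Reasoning

sgn-consecutive : ∀ k x → sgn (suc k) (sgn k x) ≡ ⊖ x
sgn-consecutive k x = cong ⊖_ (sgn-involutive k x)

sgn-distrib-⊕ : ∀ k x y → sgn k (x ⊕ y) ≡ sgn k x ⊕ sgn k y
sgn-distrib-⊕ zero    x y = refl
sgn-distrib-⊕ (suc k) x y = trans (cong ⊖_ (sgn-distrib-⊕ k x y)) (⊖-distrib-⊕ (sgn k x) (sgn k y))

⊗-sgn : ∀ k x y → x ⊗ sgn k y ≡ sgn k (x ⊗ y)
⊗-sgn zero    x y = refl
⊗-sgn (suc k) x y = trans (⊗-⊖ x (sgn k y)) (cong ⊖_ (⊗-sgn k x y))

sgn-𝟘 : ∀ k → sgn k 𝟘 ≡ 𝟘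
sgn-𝟘 zero    = refl
sgn-𝟘 (suc k) = cong ⊖_ (sgn-𝟘 k)

term-zeroˡ : ∀ k {x y} → x ≡ 𝟘 → sgn k (x ⊗ y) ≡ 𝟘
term-zeroˡ k {y = y} refl = trans (cong (sgn k) (⊗-zeroˡ y)) (sgn-𝟘 k)

term-zeroʳ : ∀ k {x y} → y ≡ 𝟘 → sgn k (x ⊗ y) ≡ 𝟘
term-zeroʳ k {x} refl = trans (cong (sgn k) (⊗-zeroʳ x)) (sgn-𝟘 k)

-- Collecting signs: the shape in which the two Laplace terms of the recurrence
-- recombine into a single signed sum.
collect-signs : ∀ m t c x y →
  ⊖ sgn t x ⊕ sgn (suc m) (c ⊗ sgn (m ℕ.+ t) y) ≡ sgn (suc m ℕ.+ (m ℕ.+ t)) (x ⊕ c ⊗ y)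
collect-signs m t c x y = begin
  ⊖ sgn t x ⊕ sgn (suc m) (c ⊗ sgn (m ℕ.+ t) y)
    ≡⟨ cong₂ _⊕_ (sym first) (cong (sgn (suc m)) (⊗-sgn (m ℕ.+ t) c y)) ⟩
  sgn (suc m) (sgn (m ℕ.+ t) x) ⊕ sgn (suc m) (sgn (m ℕ.+ t) (c ⊗ y))
    ≡⟨ sym (sgn-distrib-⊕ (suc m) _ _) ⟩
  sgn (suc m) (sgn (m ℕ.+ t) x ⊕ sgn (m ℕ.+ t) (c ⊗ y))
    ≡⟨ cong (sgn (suc m)) (sym (sgn-distrib-⊕ (m ℕ.+ t) x (c ⊗ y))) ⟩
  sgn (suc m) (sgn (m ℕ.+ t) (x ⊕ c ⊗ y))
    ≡⟨ sym (sgn-+ (suc m) (m ℕ.+ t) (x ⊕ c ⊗ y)) ⟩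
  sgn (suc m ℕ.+ (m ℕ.+ t)) (x ⊕ c ⊗ y) ∎
  where
  open ≡-Reasoning
  first : sgn (suc m) (sgn (m ℕ.+ t) x) ≡ ⊖ sgn t x
  first = trans (cong (λ u → sgn (suc m) u) (sgn-+ m t x)) (sgn-consecutive m (sgn t x))

-- The triangular numbers T(m) = 0 + 1 + … + (m-1), the exponent of the sign of
-- the anti-diagonal permutation of size m.
triangle : ℕ → ℕ
triangle zero    = 0
triangle (suc m) = m ℕ.+ triangle m

-- T(k+4) = T(k) + k + (k+1) + (k+2) + (k+3), and the four new summands pair off.
sgn-triangle-4+ : ∀ k x → sgn (triangle (4 ℕ.+ k)) x ≡ sgn (triangle k) x
sgn-triangle-4+ k x = begin
  sgn (3 ℕ.+ k ℕ.+ (2 ℕ.+ k ℕ.+ (1 ℕ.+ k ℕ.+ (k ℕ.+ t)))) x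
    ≡⟨ trans (sgn-+ (3 ℕ.+ k) _ x) (cong (sgn (3 ℕ.+ k)) (sgn-+ (2 ℕ.+ k) _ x)) ⟩
  sgn (3 ℕ.+ k) (sgn (2 ℕ.+ k) (sgn (1 ℕ.+ k ℕ.+ (k ℕ.+ t)) x))
    ≡⟨ sgn-consecutive (2 ℕ.+ k) _ ⟩
  ⊖ sgn (1 ℕ.+ k ℕ.+ (k ℕ.+ t)) x
    ≡⟨ cong ⊖_ (trans (sgn-+ (1 ℕ.+ k) _ x) (cong (sgn (1 ℕ.+ k)) (sgn-+ k t x))) ⟩
  ⊖ sgn (1 ℕ.+ k) (sgn k (sgn t x))
    ≡⟨ cong ⊖_ (sgn-consecutive k (sgn t x)) ⟩
  ⊖ ⊖ sgn t x
    ≡⟨ ⊖-involutive (sgn t x) ⟩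
  sgn t x ∎
  where
  open ≡-Reasoning
  t = triangle k

sgn-triangle : ∀ n x → ((n % 4 ≡ 0 ⊎ n % 4 ≡ 1) → sgn (triangle n) x ≡ x)
                     × ((n % 4 ≡ 2 ⊎ n % 4 ≡ 3) → sgn (triangle n) x ≡ ⊖ x)
sgn-triangle 0 x = (λ _ → refl) , λ { (inj₁ ()) ; (inj₂ ()) }
sgn-triangle 1 x = (λ _ → refl) , λ { (inj₁ ()) ; (inj₂ ()) }
sgn-triangle 2 x = (λ { (inj₁ ()) ; (inj₂ ()) }) , (λ _ → refl)
sgn-triangle 3 x = (λ { (inj₁ ()) ; (inj₂ ()) }) , (λ _ → ⊖-involutive (⊖ x))
sgn-triangle (suc (suc (suc (suc k)))) x with sgn-triangle k x
... | plus , minus = (λ r → trans (sgn-triangle-4+ k x) (plus r))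
                   , (λ r → trans (sgn-triangle-4+ k x) (minus r))

Σ-cong : ∀ {n} {f g : Fin n → ℤ[i]} → (∀ j → f j ≡ g j) → Σ f ≡ Σ g
Σ-cong {zero}  e = refl
Σ-cong {suc n} e = cong₂ _⊕_ (e Fin.zero) (Σ-cong (λ j → e (Fin.suc j)))

Σ-zero : ∀ {n} {f : Fin n → ℤ[i]} → (∀ j → f j ≡ 𝟘) → Σ f ≡ 𝟘
Σ-zero {zero}  e = refl
Σ-zero {suc n} e = cong₂ _⊕_ (e Fin.zero) (Σ-zero (λ j → e (Fin.suc j)))

penultimate : ∀ m → Fin (suc (suc m))
penultimate m = inject₁ (fromℕ m)

ultimate : ∀ m → Fin (suc (suc m))
ultimate m = fromℕ (suc m)

toℕ-penultimate : ∀ m → toℕ (penultimate m) ≡ m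
toℕ-penultimate m = trans (FinP.toℕ-inject₁ (fromℕ m)) (FinP.toℕ-fromℕ m)

Σ-last-two : ∀ m (f : Fin (suc (suc m)) → ℤ[i]) → (∀ j → toℕ j < m → f j ≡ 𝟘) →
             Σ f ≡ f (penultimate m) ⊕ f (ultimate m)
Σ-last-two zero    f z = cong (f Fin.zero ⊕_) (⊕-identityʳ _)
Σ-last-two (suc m) f z = begin
  f Fin.zero ⊕ Σ (λ j → f (Fin.suc j))  ≡⟨ cong (_⊕ Σ (λ j → f (Fin.suc j))) (z Fin.zero (s≤s z≤n)) ⟩
  𝟘 ⊕ Σ (λ j → f (Fin.suc j))           ≡⟨ ⊕-identityˡ _ ⟩
  Σ (λ j → f (Fin.suc j))               ≡⟨ Σ-last-two m (λ j → f (Fin.suc j)) (λ j p → z (Fin.suc j) (s≤s p)) ⟩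
  f (penultimate (suc m)) ⊕ f (ultimate (suc m)) ∎
  where open ≡-Reasoning

minor : ∀ {n} → Matrix (suc n) → Fin (suc n) → Matrix n
minor M j r c = M (Fin.suc r) (punchIn j c)

cofactorTerm : ∀ {n} → Matrix (suc n) → Fin (suc n) → ℤ[i]
cofactorTerm {n} M j = sgn (toℕ j) (M Fin.zero j ⊗ det n (minor M j))

det-cong : ∀ n {M N : Matrix n} → (∀ r c → M r c ≡ N r c) → det n M ≡ det n N
det-cong zero    e = refl
det-cong (suc n) e = Σ-cong λ j →
  cong₂ (λ u v → sgn (toℕ j) (u ⊗ v)) (e Fin.zero j) (det-cong n (λ r c → e (Fin.suc r) (punchIn j c)))

-- A matrix with a zero column has determinant 0 (induction on the size: every
-- minor either misses the row-0 entry of that column or still contains the column).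
det-zero-column : ∀ n (M : Matrix n) k → (∀ r → M r k ≡ 𝟘) → det n M ≡ 𝟘
det-zero-column (suc n) M k z = Σ-zero term
  where
  term : ∀ j → cofactorTerm M j ≡ 𝟘
  term j with j FinP.≟ k
  ... | yes refl = term-zeroˡ (toℕ j) (z Fin.zero)
  ... | no j≢k   = term-zeroʳ (toℕ j) {M Fin.zero j}
        (det-zero-column n (minor M j) (punchOut j≢k)
          (λ r → trans (cong (M (Fin.suc r)) (FinP.punchIn-punchOut j≢k)) (z (Fin.suc r))))

<⇒≡ᵇ-false : ∀ {a b} → a < b → (a ≡ᵇ b) ≡ false
<⇒≡ᵇ-false {zero}  {suc b} _       = refl
<⇒≡ᵇ-false {suc a} {suc b} (s≤s p) = <⇒≡ᵇ-false p

>⇒≡ᵇ-false : ∀ {a b} → b < a → (a ≡ᵇ b) ≡ false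
>⇒≡ᵇ-false {suc a} {zero}  _       = refl
>⇒≡ᵇ-false {suc a} {suc b} (s≤s p) = >⇒≡ᵇ-false p

≡ᵇ-refl : ∀ a → (a ≡ᵇ a) ≡ true
≡ᵇ-refl zero    = refl
≡ᵇ-refl (suc a) = ≡ᵇ-refl a

toℕ-punchIn-< : ∀ {n} (j : Fin (suc n)) (c : Fin n) → toℕ c < toℕ j → toℕ (punchIn j c) ≡ toℕ c
toℕ-punchIn-< {suc n} (Fin.suc j) Fin.zero    _       = refl
toℕ-punchIn-< {suc n} (Fin.suc j) (Fin.suc c) (s≤s p) = cong suc (toℕ-punchIn-< j c p)

toℕ-punchIn-≥ : ∀ {n} (j : Fin (suc n)) (c : Fin n) → toℕ j ≤ toℕ c → toℕ (punchIn j c) ≡ suc (toℕ c)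
toℕ-punchIn-≥ Fin.zero c _ = refl
toℕ-punchIn-≥ {suc n} (Fin.suc j) (Fin.suc c) (s≤s p) = cong suc (toℕ-punchIn-≥ j c p)

bandEntry : ℤ[i] → Bool → Bool → Bool → ℤ[i]
bandEntry x onAnti below above = if onAnti then x else (if below ∨ above then 𝕚 else 𝟘)

bandEntry-cong : ∀ x {a a′ b b′ c c′} → a ≡ a′ → b ≡ b′ → c ≡ c′ →
                 bandEntry x a b c ≡ bandEntry x a′ b′ c′
bandEntry-cong x refl refl refl = refl

antiEntry : ℕ → (ℕ → ℤ[i]) → ℕ → ℕ → ℤ[i]
antiEntry m d r c = bandEntry (d r) (suc (r ℕ.+ c) ≡ᵇ m) (r ℕ.+ c ≡ᵇ m) (suc (suc (r ℕ.+ c)) ≡ᵇ m)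

A : ∀ m → (ℕ → ℤ[i]) → Matrix m
A m d r c = antiEntry m d (toℕ r) (toℕ c)

-- The diagonal of a lower-right block: the minors arising in the recurrence are
-- A_{m-k}(drop k d) after the first k rows of A_m(d) are deleted.
drop : ℕ → (ℕ → ℤ[i]) → ℕ → ℤ[i]
drop k d r = d (k ℕ.+ r)

row₀-before : ∀ m d x → x < m → antiEntry (suc (suc m)) d 0 x ≡ 𝟘
row₀-before m d x p = bandEntry-cong (d 0) (<⇒≡ᵇ-false (ℕP.m<n⇒m<1+n p))
  (<⇒≡ᵇ-false (ℕP.m<n⇒m<1+n (ℕP.m<n⇒m<1+n p))) (<⇒≡ᵇ-false p)

row₀-penultimate : ∀ m d → antiEntry (suc (suc m)) d 0 m ≡ 𝕚
row₀-penultimate m d = bandEntry-cong (d 0) (<⇒≡ᵇ-false (ℕP.n<1+n m))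
  (<⇒≡ᵇ-false (ℕP.m<n⇒m<1+n (ℕP.n<1+n m))) (≡ᵇ-refl m)

row₀-ultimate : ∀ m d → antiEntry (suc (suc m)) d 0 (suc m) ≡ d 0
row₀-ultimate m d = bandEntry-cong (d 0) {b′ = m ≡ᵇ suc m} {c′ = suc (suc m) ≡ᵇ suc m}
  (≡ᵇ-refl m) refl refl

row₁-before : ∀ m d x → x < m → antiEntry (suc (suc (suc m))) d 1 x ≡ 𝟘
row₁-before m d x p = bandEntry-cong (d 1) (<⇒≡ᵇ-false (ℕP.m<n⇒m<1+n p))
  (<⇒≡ᵇ-false (ℕP.m<n⇒m<1+n (ℕP.m<n⇒m<1+n p))) (<⇒≡ᵇ-false p)

row₁-ultimate : ∀ m d → antiEntry (suc (suc (suc m))) d 1 (suc (suc m)) ≡ 𝕚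
row₁-ultimate m d = bandEntry-cong (d 1) {c′ = suc (suc m) ≡ᵇ m}
  (>⇒≡ᵇ-false (ℕP.n<1+n m)) (≡ᵇ-refl m) refl

ultimate-column-below-row₁ : ∀ m d r → antiEntry (suc (suc (suc m))) d (suc (suc r)) (suc (suc m)) ≡ 𝟘
ultimate-column-below-row₁ m d r = bandEntry-cong (d (suc (suc r)))
  (>⇒≡ᵇ-false m<) (>⇒≡ᵇ-false 1+m<) (>⇒≡ᵇ-false (ℕP.m<n⇒m<1+n m<))
  where
  1+m< : suc m < r ℕ.+ suc (suc m)
  1+m< = ℕP.m≤n+m (suc (suc m)) r
  m< : m < r ℕ.+ suc (suc m)
  m< = ℕP.<-trans (ℕP.n<1+n m) 1+m<

toℕ-below-ultimate : ∀ {m} (c : Fin (suc m)) → toℕ c < toℕ (ultimate m)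
toℕ-below-ultimate {m} c = subst (toℕ c <_) (sym (FinP.toℕ-fromℕ (suc m))) (FinP.toℕ<n c)

minor-ultimate : ∀ m d r c → minor (A (suc (suc m)) d) (ultimate m) r c ≡ A (suc m) (drop 1 d) r c
minor-ultimate m d r c =
  cong (antiEntry (suc (suc m)) d (suc (toℕ r))) (toℕ-punchIn-< (ultimate m) c (toℕ-below-ultimate c))

punchIn-penultimate-< : ∀ m (j : Fin (suc (suc m))) → toℕ j < suc m →
                        toℕ (punchIn (penultimate (suc m)) j) ≡ toℕ j
punchIn-penultimate-< m j p =
  toℕ-punchIn-< (penultimate (suc m)) j (subst (toℕ j <_) (sym (toℕ-penultimate (suc m))) p)

punchIn-penultimate-≥ : ∀ m (j : Fin (suc (suc m))) → suc m ≤ toℕ j →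
                        toℕ (punchIn (penultimate (suc m)) j) ≡ suc (toℕ j)
punchIn-penultimate-≥ m j p =
  toℕ-punchIn-≥ (penultimate (suc m)) j (subst (_≤ toℕ j) (sym (toℕ-penultimate (suc m))) p)

-- N = minor of A_{m+3}(d) at column m+1.  Deleting its row 0 and column m keeps
-- the last column of A_{m+3}(d), which vanishes below row 1 ...
minor-minor-penultimate-column : ∀ m d r →
  minor (minor (A (suc (suc (suc m))) d) (penultimate (suc m))) (penultimate m) r (fromℕ m) ≡ 𝟘
minor-minor-penultimate-column m d r =
  trans (cong (antiEntry (suc (suc (suc m))) d (suc (suc (toℕ r)))) last-column)
        (ultimate-column-below-row₁ m d (toℕ r))
  where
  inner : toℕ (punchIn (penultimate m) (fromℕ m)) ≡ suc m
  inner = trans (toℕ-punchIn-≥ (penultimate m) (fromℕ m)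
                  (subst₂ _≤_ (sym (toℕ-penultimate m)) (sym (FinP.toℕ-fromℕ m)) ℕP.≤-refl))
                (cong suc (FinP.toℕ-fromℕ m))
  last-column : toℕ (punchIn (penultimate (suc m)) (punchIn (penultimate m) (fromℕ m))) ≡ suc (suc m)
  last-column = trans (punchIn-penultimate-≥ m _ (ℕP.≤-reflexive (sym inner))) (cong suc inner)

minor-minor-ultimate : ∀ m d r c →
  minor (minor (A (suc (suc (suc m))) d) (penultimate (suc m))) (ultimate m) r c
  ≡ A (suc m) (drop 2 d) r c
minor-minor-ultimate m d r c = cong (antiEntry (suc (suc (suc m))) d (suc (suc (toℕ r))))
  (trans (punchIn-penultimate-< m (punchIn (ultimate m) c)
           (subst (_< suc m) (sym keep) (FinP.toℕ<n c)))
         keep)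
  where
  keep : toℕ (punchIn (ultimate m) c) ≡ toℕ c
  keep = toℕ-punchIn-< (ultimate m) c (toℕ-below-ultimate c)

-- Deleting row 0 and column m of A_{m+2}(d) leaves a matrix N whose first row is
-- (0, …, 0, i, i); by the two facts above only the last term of its expansion
-- survives, so det N = (-1)^m · i · det A_m(drop 2 d).
det-minor-penultimate : ∀ m d →
  det (suc m) (minor (A (suc (suc m)) d) (penultimate m)) ≡ sgn m (𝕚 ⊗ det m (A m (drop 2 d)))
det-minor-penultimate zero    d = ⊕-identityʳ _
det-minor-penultimate (suc m) d =
  trans (Σ-last-two m (cofactorTerm N) vanishing) (trans (cong₂ _⊕_ middle last) (⊕-identityˡ _))
  where
  N = minor (A (suc (suc (suc m))) d) (penultimate (suc m))
  vanishing : ∀ j → toℕ j < m → cofactorTerm N j ≡ 𝟘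
  vanishing j p = term-zeroˡ (toℕ j)
    (trans (cong (antiEntry (suc (suc (suc m))) d 1) (punchIn-penultimate-< m j (ℕP.m<n⇒m<1+n p)))
           (row₁-before m d (toℕ j) p))
  middle : cofactorTerm N (penultimate m) ≡ 𝟘
  middle = term-zeroʳ (toℕ (penultimate m)) {N Fin.zero (penultimate m)}
    (det-zero-column (suc m) (minor N (penultimate m)) (fromℕ m) (minor-minor-penultimate-column m d))
  last : cofactorTerm N (ultimate m) ≡ sgn (suc m) (𝕚 ⊗ det (suc m) (A (suc m) (drop 2 d)))
  last = cong₂ sgn (FinP.toℕ-fromℕ (suc m)) (cong₂ _⊗_
    (trans (cong (antiEntry (suc (suc (suc m))) d 1)
                 (trans (punchIn-penultimate-≥ m (ultimate m) (ℕP.≤-reflexive (sym (FinP.toℕ-fromℕ (suc m)))))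
                        (cong suc (FinP.toℕ-fromℕ (suc m)))))
           (row₁-ultimate m d))
    (det-cong (suc m) (minor-minor-ultimate m d)))

det-A-recurrence : ∀ m d → det (suc (suc m)) (A (suc (suc m)) d) ≡
  ⊖ det m (A m (drop 2 d)) ⊕ sgn (suc m) (d 0 ⊗ det (suc m) (A (suc m) (drop 1 d)))
det-A-recurrence m d = trans (Σ-last-two m (cofactorTerm (A (suc (suc m)) d)) vanishing)
                             (cong₂ _⊕_ penultimate-term ultimate-term)
  where
  X = det m (A m (drop 2 d))
  vanishing : ∀ j → toℕ j < m → cofactorTerm (A (suc (suc m)) d) j ≡ 𝟘
  vanishing j p = term-zeroˡ (toℕ j) (row₀-before m d (toℕ j) p)
  penultimate-term : cofactorTerm (A (suc (suc m)) d) (penultimate m) ≡ ⊖ X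
  penultimate-term = begin
    cofactorTerm (A (suc (suc m)) d) (penultimate m)
      ≡⟨ cong₂ sgn (toℕ-penultimate m)
           (cong₂ _⊗_ (trans (cong (antiEntry (suc (suc m)) d 0) (toℕ-penultimate m)) (row₀-penultimate m d))
                      (det-minor-penultimate m d)) ⟩
    sgn m (𝕚 ⊗ sgn m (𝕚 ⊗ X))  ≡⟨ cong (sgn m) (⊗-sgn m 𝕚 (𝕚 ⊗ X)) ⟩
    sgn m (sgn m (𝕚 ⊗ (𝕚 ⊗ X))) ≡⟨ sgn-involutive m _ ⟩
    𝕚 ⊗ (𝕚 ⊗ X)                ≡⟨ 𝕚-squared X ⟩
    ⊖ X                         ∎
    where open ≡-Reasoning
  ultimate-term : cofactorTerm (A (suc (suc m)) d) (ultimate m) ≡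
                  sgn (suc m) (d 0 ⊗ det (suc m) (A (suc m) (drop 1 d)))
  ultimate-term = cong₂ sgn (FinP.toℕ-fromℕ (suc m)) (cong₂ _⊗_
    (trans (cong (antiEntry (suc (suc m)) d 0) (FinP.toℕ-fromℕ (suc m))) (row₀-ultimate m d))
    (det-cong (suc m) (minor-ultimate m d)))

diagonalB : ℕ → ℤ[i] → ℕ → ℤ[i]
diagonalB n a r = if (r ≡ᵇ 0) ∨ (suc r ≡ᵇ n) then a ⊕ 𝕚 else a

-- On the anti-diagonal r + c + 1 = n, the column c is 0 exactly when the row r is n - 1.
column-zero⇔last-row : ∀ r c → (c ≡ᵇ 0) ≡ (suc r ≡ᵇ suc (r ℕ.+ c))
column-zero⇔last-row r zero    = sym (trans (cong (r ≡ᵇ_) (ℕP.+-identityʳ r)) (≡ᵇ-refl r))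
column-zero⇔last-row r (suc c) = sym (<⇒≡ᵇ-false (ℕP.m<m+n r (s≤s z≤n)))

B-as-A : ∀ n a r c → B n a r c ≡ A n (diagonalB n a) r c
B-as-A n a r c with suc (toℕ r ℕ.+ toℕ c) ≡ᵇ n in onAnti
... | false = refl
... | true  = cong (λ b → if (toℕ r ≡ᵇ 0) ∨ b then a ⊕ 𝕚 else a)
  (trans (column-zero⇔last-row (toℕ r) (toℕ c))
         (cong (suc (toℕ r) ≡ᵇ_) (ℕP.≡ᵇ⇒≡ (suc (toℕ r ℕ.+ toℕ c)) n (subst T (sym onAnti) tt))))

module LucasDeterminant (a : ℕ) (f : ℕ → ℕ) (f₀ : f 0 ≡ 0) (f₁ : f 1 ≡ 1)
                        (f-rec : ∀ m → f (suc (suc m)) ≡ a ℕ.* f (suc m) ℕ.+ f m) where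

  -- The sign-free determinant U_m = f_{m+1} + f_m · i.
  U : ℕ → ℤ[i]
  U m = (+ f (suc m)) + (+ f m) i

  f-rec-ℤ : ∀ m → + f (suc (suc m)) ≡ (+ a) ℤ.* (+ f (suc m)) ℤ.+ (+ f m)
  f-rec-ℤ m = trans (cong +_ (f-rec m))
                (trans (ℤP.pos-+ (a ℕ.* f (suc m)) (f m)) (cong (ℤ._+ + f m) (ℤP.pos-* a (f (suc m)))))

  U-rec : ∀ m → U (suc (suc m)) ≡ U m ⊕ ι a ⊗ U (suc m)
  U-rec m = ≡-parts (trans (f-rec-ℤ (suc m)) (real-part (+ a) _ _))
                    (trans (f-rec-ℤ m) (imaginary-part (+ a) _ _ (+ f (suc (suc m)))))
    where
    real-part : ∀ (a y x : ℤ.ℤ) → a ℤ.* y ℤ.+ x ≡ x ℤ.+ (a ℤ.* y ℤ.- + 0 ℤ.* x)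
    real-part = solve-∀
    imaginary-part : ∀ (a y x z : ℤ.ℤ) → a ℤ.* y ℤ.+ x ≡ x ℤ.+ (a ℤ.* y ℤ.+ + 0 ℤ.* z)
    imaginary-part = solve-∀

  lastPerturbed : ℕ → ℕ → ℤ[i]
  lastPerturbed m r = if suc r ≡ᵇ m then ι a ⊕ 𝕚 else ι a

  U₁ : (ι a ⊕ 𝕚) ⊗ 𝟙 ≡ U 1
  U₁ = ≡-parts (trans (real-part (+ a)) (cong +_ (sym f₂)))
               (trans (imaginary-part (+ a)) (cong +_ (sym f₁)))
    where
    f₂ : f 2 ≡ a
    f₂ = trans (f-rec 0) (trans (cong₂ (λ u v → a ℕ.* u ℕ.+ v) f₁ f₀)
           (trans (ℕP.+-identityʳ _) (ℕP.*-identityʳ a)))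
    real-part : ∀ (a : ℤ.ℤ) → (a ℤ.+ + 0) ℤ.* + 1 ℤ.- (+ 0 ℤ.+ + 1) ℤ.* + 0 ≡ a
    real-part = solve-∀
    imaginary-part : ∀ (a : ℤ.ℤ) → (a ℤ.+ + 0) ℤ.* + 0 ℤ.+ (+ 0 ℤ.+ + 1) ℤ.* + 1 ≡ + 1
    imaginary-part = solve-∀

  det-A-lastPerturbed : ∀ m d → (∀ r → d r ≡ lastPerturbed m r) →
                        det m (A m d) ≡ sgn (triangle m) (U m)
  det-A-lastPerturbed zero          d d≡ = ≡-parts (cong +_ (sym f₁)) (cong +_ (sym f₀))
  det-A-lastPerturbed (suc zero)    d d≡ = trans (⊕-identityʳ (d 0 ⊗ 𝟙)) (trans (cong (_⊗ 𝟙) (d≡ 0)) U₁)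
  det-A-lastPerturbed (suc (suc m)) d d≡ = begin
    det (suc (suc m)) (A (suc (suc m)) d)
      ≡⟨ det-A-recurrence m d ⟩
    ⊖ det m (A m (drop 2 d)) ⊕ sgn (suc m) (d 0 ⊗ det (suc m) (A (suc m) (drop 1 d)))
      ≡⟨ cong₂ (λ u v → ⊖ u ⊕ sgn (suc m) v)
           (det-A-lastPerturbed m (drop 2 d) (λ r → d≡ (suc (suc r))))
           (cong₂ _⊗_ (d≡ 0) (det-A-lastPerturbed (suc m) (drop 1 d) (λ r → d≡ (suc r)))) ⟩
    ⊖ sgn (triangle m) (U m) ⊕ sgn (suc m) (ι a ⊗ sgn (m ℕ.+ triangle m) (U (suc m)))
      ≡⟨ collect-signs m (triangle m) (ι a) (U m) (U (suc m)) ⟩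
    sgn (triangle (suc (suc m))) (U m ⊕ ι a ⊗ U (suc m))
      ≡⟨ cong (sgn (triangle (suc (suc m)))) (sym (U-rec m)) ⟩
    sgn (triangle (suc (suc m))) (U (suc (suc m))) ∎
    where open ≡-Reasoning

  closing-combination : ∀ m → U m ⊕ (ι a ⊕ 𝕚) ⊗ U (suc m) ≡ ((+ a) + (+ 2) i) ⊗ ι (f (suc (suc m)))
  closing-combination m = ≡-parts (real-part (+ a) (+ f (suc m)) (+ f (suc (suc m))))
                                  (imaginary-part (+ a) _ _ _ (f-rec-ℤ m))
    where
    real-part : ∀ (a y z : ℤ.ℤ) → y ℤ.+ ((a ℤ.+ + 0) ℤ.* z ℤ.- (+ 0 ℤ.+ + 1) ℤ.* y) ≡ a ℤ.* z ℤ.- + 2 ℤ.* + 0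
    real-part = solve-∀
    solved : ∀ (a x y : ℤ.ℤ) → x ℤ.+ ((a ℤ.+ + 0) ℤ.* y ℤ.+ (+ 0 ℤ.+ + 1) ℤ.* (a ℤ.* y ℤ.+ x))
             ≡ a ℤ.* + 0 ℤ.+ + 2 ℤ.* (a ℤ.* y ℤ.+ x)
    solved = solve-∀
    imaginary-part : ∀ (a x y z : ℤ.ℤ) → z ≡ a ℤ.* y ℤ.+ x →
                     x ℤ.+ ((a ℤ.+ + 0) ℤ.* y ℤ.+ (+ 0 ℤ.+ + 1) ℤ.* z) ≡ a ℤ.* + 0 ℤ.+ + 2 ℤ.* z
    imaginary-part a x y _ refl = solved a x y

  det-B : ∀ m → det (suc (suc m)) (B (suc (suc m)) (ι a))
                ≡ sgn (triangle (suc (suc m))) (((+ a) + (+ 2) i) ⊗ ι (f (suc (suc m))))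
  det-B m = begin
    det (suc (suc m)) (B (suc (suc m)) (ι a))
      ≡⟨ det-cong (suc (suc m)) (B-as-A (suc (suc m)) (ι a)) ⟩
    det (suc (suc m)) (A (suc (suc m)) d)
      ≡⟨ det-A-recurrence m d ⟩
    ⊖ det m (A m (drop 2 d)) ⊕ sgn (suc m) ((ι a ⊕ 𝕚) ⊗ det (suc m) (A (suc m) (drop 1 d)))
      ≡⟨ cong₂ (λ u v → ⊖ u ⊕ sgn (suc m) ((ι a ⊕ 𝕚) ⊗ v))
           (det-A-lastPerturbed m (drop 2 d) (λ r → refl))
           (det-A-lastPerturbed (suc m) (drop 1 d) (λ r → refl)) ⟩
    ⊖ sgn (triangle m) (U m) ⊕ sgn (suc m) ((ι a ⊕ 𝕚) ⊗ sgn (m ℕ.+ triangle m) (U (suc m)))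
      ≡⟨ collect-signs m (triangle m) (ι a ⊕ 𝕚) (U m) (U (suc m)) ⟩
    sgn (triangle (suc (suc m))) (U m ⊕ (ι a ⊕ 𝕚) ⊗ U (suc m))
      ≡⟨ cong (sgn (triangle (suc (suc m)))) (closing-combination m) ⟩
    sgn (triangle (suc (suc m))) (((+ a) + (+ 2) i) ⊗ ι (f (suc (suc m)))) ∎
    where
    open ≡-Reasoning
    d = diagonalB (suc (suc m)) (ι a)

module Fibonacci = LucasDeterminant 1 fib refl refl
  (λ m → cong (ℕ._+ fib m) (sym (ℕP.*-identityˡ (fib (suc m)))))
module Pell = LucasDeterminant 2 pell refl refl (λ m → refl)

theorem11 : (n : ℕ) → 2 ≤ n →
    ((n % 4 ≡ 0 ⊎ n % 4 ≡ 1) → det n (B n (ι 1)) ≡ ((+ 1) + (+ 2) i) ⊗ ι (fib n))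
    × ((n % 4 ≡ 2 ⊎ n % 4 ≡ 3) → det n (B n (ι 1)) ≡ ⊖ (((+ 1) + (+ 2) i) ⊗ ι (fib n)))
    × ((n % 4 ≡ 0 ⊎ n % 4 ≡ 1) → det n (B n (ι 2)) ≡ ((+ 2) + (+ 2) i) ⊗ ι (pell n))
    × ((n % 4 ≡ 2 ⊎ n % 4 ≡ 3) → det n (B n (ι 2)) ≡ ⊖ (((+ 2) + (+ 2) i) ⊗ ι (pell n)))
theorem11 n@(suc (suc m)) (s≤s (s≤s z≤n))
  with sgn-triangle n (((+ 1) + (+ 2) i) ⊗ ι (fib n))
     | sgn-triangle n (((+ 2) + (+ 2) i) ⊗ ι (pell n))
... | fib-plus , fib-minus | pell-plus , pell-minus =
    (λ n≡01 → trans (Fibonacci.det-B m) (fib-plus n≡01))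
  , (λ n≡23 → trans (Fibonacci.det-B m) (fib-minus n≡23))
  , (λ n≡01 → trans (Pell.det-B m) (pell-plus n≡01))
  , (λ n≡23 → trans (Pell.det-B m) (pell-minus n≡23))
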